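{- For every integer $k \geq 2$, if a bipartite graph $G$ has minimum degree at least $k(k-1)$, then $G$ has a $\frac{1}{k}$-majority $(k+1)$-edge-colouring.
   Context: Graphs are finite and simple. For an integer $k\geq 2$, a $\frac{1}{k}$-majority $l$-edge-colouring of a graph $G$ is an assignment to each edge of $G$ of one of $l$ colours such that for every colour $i$ and every vertex $v$ of $G$, at most $\frac{d_G(v)}{k}$ of the edges incident with $v$ have colour $i$ (where $d_G(v)$ is the degree of $v$). -}

module Defs where

open import Data.Nat using (ℕ; zero; suc; _+_; _*_; _≤_)
open import Data.Bool using (Bool; true; false; _∧_; if_then_else_)
open import Data.Fin using (Fin; zero; suc)
open import Data.Fin.Properties using (_≟_)
open import Data.Product using (Σ; _×_)
open import Relation.Binary.PropositionalEquality using (_≡_; _≢_)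
open import Relation.Nullary.Decidable using (⌊_⌋)

count : ∀ {n} → (Fin n → Bool) → ℕ
count {zero}  p = 0
count {suc n} p = (if p zero then 1 else 0) + count (λ i → p (suc i))

record Graph (n : ℕ) : Set where
  field
    adj    : Fin n → Fin n → Bool
    sym    : ∀ u v → adj u v ≡ adj v u
    irrefl : ∀ v → adj v v ≡ false
open Graph public

degree : ∀ {n} → Graph n → Fin n → ℕ
degree G v = count (λ w → adj G v w)

Bipartite : ∀ {n} → Graph n → Set
Bipartite {n} G = Σ (Fin n → Bool) λ side →
  ∀ u v → adj G u v ≡ true → side u ≢ side v

MinDegreeAtLeast : ∀ {n} → Graph n → ℕ → Set
MinDegreeAtLeast G d = ∀ v → d ≤ degree G v

-- an l-edge-colouring: each edge uv gets a colour c u v = c v u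
-- (values on non-edges are irrelevant)
EdgeColouring : ∀ {n} → Graph n → ℕ → Set
EdgeColouring {n} G l = Σ (Fin n → Fin n → Fin l) λ c →
  ∀ u v → adj G u v ≡ true → c u v ≡ c v u

colourDegree : ∀ {n l} (G : Graph n) → (Fin n → Fin n → Fin l) → Fin n → Fin l → ℕ
colourDegree G c v i = count (λ w → adj G v w ∧ ⌊ c v w ≟ i ⌋)

-- 1/k-majority: for all colours i and vertices v, (#edges at v of colour i) ≤ d(v)/k,
-- stated without division as k * #(...) ≤ d(v)
IsMajorityColouring : ∀ {n l} (G : Graph n) → ℕ → (Fin n → Fin n → Fin l) → Set
IsMajorityColouring {n} {l} G k c = ∀ (v : Fin n) (i : Fin l) → k * colourDegree G c v i ≤ degree G v

HasMajorityColouring : ∀ {n} → Graph n → ℕ → ℕ → Set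
HasMajorityColouring {n} G k l = Σ (EdgeColouring G l) λ ec → IsMajorityColouring G k (Data.Product.proj₁ ec)

-- Colour the edges with k + 1 colours equitably, i.e. so that at every vertex any two colour
-- degrees differ by at most one. If colour i occurs m ≥ k times at v, every other colour occurs at
-- least m − 1 times, so d(v) ≥ m + k(m − 1) ≥ km; if m < k then km ≤ k(k − 1) ≤ d(v).
--
-- Every bipartite graph has an equitable colouring with any number of colours: take a colouring of
-- minimal energy Σ_v Σ_i d_i(v)². If d_a(v) ≥ d_b(v) + 2, walk from v along an a-edge to w. If a is
-- heavier than b at w, stop; otherwise continue from w, in the graph without the edge vw and with
-- the roles of a and b exchanged. Exchanging a and b along this trail keeps both colour degrees of
-- every inner vertex, strictly lowers the energy at v and does not raise it at the end vertex, which
-- by bipartiteness is not v.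
module Submission where

open import Data.Bool using (Bool; true; false; _∧_; not; if_then_else_)
open import Data.Bool.Properties using (∧-zeroʳ; ∧-identityʳ; ¬-not; not-involutive)
open import Data.Fin using (Fin; zero; suc; punchIn)
open import Data.Fin.Properties using (_≟_; suc-injective; all?; ¬∀⟶∃¬)
open import Data.Nat using (ℕ; zero; suc; _+_; _*_; _∸_; _≤_; _<_; z≤n; s≤s; _≤?_; _<?_)
open import Data.Nat.Induction using (<-wellFounded)
open import Data.Nat.Properties
  using ( +-0-commutativeMonoid; +-commutativeSemigroup; +-assoc; *-suc
        ; ≤-refl; ≤-reflexive; ≤-trans; <-trans; <⇒≤; <⇒≱; ≮⇒≥; ≰⇒>; n≤1+n; n<1+n; m≤n+m
        ; +-mono-≤; +-mono-<; +-mono-<-≤; +-mono-≤-<; +-monoˡ-≤; +-monoʳ-≤; +-monoʳ-<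
        ; +-cancelʳ-≤; +-cancelʳ-<; *-monoʳ-≤; ∸-monoˡ-≤; module ≤-Reasoning )
open import Data.Nat.Tactic.RingSolver using (solve-∀)
open import Algebra.Properties.CommutativeMonoid.Sum +-0-commutativeMonoid
  using (sum; sum-cong-≗; ∑-comm; sum-remove)
open import Algebra.Properties.CommutativeSemigroup +-commutativeSemigroup
  using (xy∙z≈zy∙x; xy∙z≈xz∙y; xy∙z≈x∙zy; x∙yz≈y∙xz)
open import Data.Product using (_×_; _,_; ∃)
import Data.Product as Prod
open import Data.Sum using (_⊎_; inj₁; inj₂)
import Data.Sum as Sum
open import Data.Vec.Functional using (updateAt; removeAt)
open import Data.Vec.Functional.Properties using (updateAt-updates; updateAt-minimal)
open import Function using (_∘_; const)
open import Function.Bundles using (mk⇔)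
open import Induction.WellFounded using (Acc; acc)
open import Relation.Binary.PropositionalEquality
  using (_≡_; _≢_; refl; sym; trans; cong; cong₂; subst; subst₂; module ≡-Reasoning)
open import Relation.Nullary using (¬_; yes; no)
open import Relation.Nullary.Decidable
  using (Dec; does; ⌊_⌋; _×-dec_; _⊎-dec_; dec-true; dec-false; does-⇔; isYes≗does)

open import Defs hiding (sym)

private variable m n l : ℕ

⌊⌋-true : ∀ {a} {A : Set a} (a? : Dec A) → A → ⌊ a? ⌋ ≡ true
⌊⌋-true a? a = trans (isYes≗does a?) (dec-true a? a)

⌊⌋-false : ∀ {a} {A : Set a} (a? : Dec A) → ¬ A → ⌊ a? ⌋ ≡ false
⌊⌋-false a? ¬a = trans (isYes≗does a?) (dec-false a? ¬a)

≢-≢⇒≡ : {x y z : Bool} → x ≢ y → y ≢ z → x ≡ z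
≢-≢⇒≡ x≢y y≢z = trans (¬-not x≢y) (trans (cong not (¬-not y≢z)) (not-involutive _))

∑-mono-≤ : {f g : Fin m → ℕ} → (∀ i → f i ≤ g i) → sum f ≤ sum g
∑-mono-≤ {zero}  f≤g = z≤n
∑-mono-≤ {suc m} f≤g = +-mono-≤ (f≤g zero) (∑-mono-≤ (f≤g ∘ suc))

∑-mono-< : {f g : Fin m → ℕ} → (∀ i → f i ≤ g i) → ∀ j → f j < g j → sum f < sum g
∑-mono-< f≤g zero    fj<gj = +-mono-<-≤ fj<gj (∑-mono-≤ (f≤g ∘ suc))
∑-mono-< f≤g (suc j) fj<gj = +-mono-≤-< (f≤g zero) (∑-mono-< (f≤g ∘ suc) j fj<gj)

∑-const : ∀ m c → sum {m} (λ _ → c) ≡ m * c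
∑-const zero    c = refl
∑-const (suc m) c = cong (c +_) (∑-const m c)

∑-update : (f g : Fin m → ℕ) (a : Fin m) → (∀ j → j ≢ a → f j ≡ g j) →
           sum f + g a ≡ sum g + f a
∑-update f g zero f≗g = begin
  f zero + sum (f ∘ suc) + g zero  ≡⟨ xy∙z≈zy∙x (f zero) _ (g zero) ⟩
  g zero + sum (f ∘ suc) + f zero  ≡⟨ cong (λ s → g zero + s + f zero)
                                           (sum-cong-≗ λ j → f≗g (suc j) λ ()) ⟩
  g zero + sum (g ∘ suc) + f zero  ∎
  where open ≡-Reasoning
∑-update f g (suc a) f≗g = begin
  f zero + sum (f ∘ suc) + g (suc a)    ≡⟨ +-assoc (f zero) _ _ ⟩
  f zero + (sum (f ∘ suc) + g (suc a))  ≡⟨ cong₂ _+_ (f≗g zero λ ()) (∑-update (f ∘ suc) (g ∘ suc) a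
                                              λ j j≢a → f≗g (suc j) (j≢a ∘ suc-injective)) ⟩
  g zero + (sum (g ∘ suc) + f (suc a))  ≡⟨ +-assoc (g zero) _ _ ⟨
  g zero + sum (g ∘ suc) + f (suc a)    ∎
  where open ≡-Reasoning

∑-update₂ : (f g : Fin m → ℕ) {a b : Fin m} → a ≢ b → (∀ j → j ≢ a → j ≢ b → f j ≡ g j) →
            sum f + (g a + g b) ≡ sum g + (f a + f b)
∑-update₂ f g {a} {b} a≢b f≗g = begin
  sum f + (g a + g b)  ≡⟨ +-assoc (sum f) _ _ ⟨
  sum f + g a + g b    ≡⟨ cong (_+ g b) (trans (cong (sum f +_) (sym ha)) (∑-update f h a f≗h)) ⟩
  sum h + f a + g b    ≡⟨ xy∙z≈xz∙y (sum h) _ _ ⟩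
  sum h + g b + f a    ≡⟨ cong (_+ f a) (trans (∑-update h g b h≗g) (cong (sum g +_) hb)) ⟩
  sum g + f b + f a    ≡⟨ xy∙z≈x∙zy (sum g) _ _ ⟩
  sum g + (f a + f b)  ∎
  where
  open ≡-Reasoning
  h : Fin _ → ℕ
  h = updateAt f a (const (g a))
  ha : h a ≡ g a
  ha = updateAt-updates a f
  hb : h b ≡ f b
  hb = updateAt-minimal b a f (a≢b ∘ sym)
  f≗h : ∀ j → j ≢ a → f j ≡ h j
  f≗h j j≢a = sym (updateAt-minimal j a f j≢a)
  h≗g : ∀ j → j ≢ b → h j ≡ g j
  h≗g j j≢b with j ≟ a
  ... | yes refl = ha
  ... | no j≢a   = trans (updateAt-minimal j a f j≢a) (f≗g j j≢a j≢b)

∑-≤-two : (f g : Fin m → ℕ) {a b : Fin m} → a ≢ b → (∀ j → j ≢ a → j ≢ b → f j ≡ g j) →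
          f a + f b ≤ g a + g b → sum f ≤ sum g
∑-≤-two f g {a} {b} a≢b f≗g le = +-cancelʳ-≤ (g a + g b) (sum f) (sum g)
  (subst (_≤ sum g + (g a + g b)) (sym (∑-update₂ f g a≢b f≗g)) (+-monoʳ-≤ (sum g) le))

∑-<-two : (f g : Fin m → ℕ) {a b : Fin m} → a ≢ b → (∀ j → j ≢ a → j ≢ b → f j ≡ g j) →
          f a + f b < g a + g b → sum f < sum g
∑-<-two f g {a} {b} a≢b f≗g lt = +-cancelʳ-< (g a + g b) (sum f) (sum g)
  (subst (_< sum g + (g a + g b)) (sym (∑-update₂ f g a≢b f≗g)) (+-monoʳ-< (sum g) lt))

private variable p q : Fin m → Bool

count-cong : (∀ y → p y ≡ q y) → count p ≡ count q
count-cong {zero}  p≗q = refl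
count-cong {suc m} p≗q =
  cong₂ _+_ (cong (λ b → if b then 1 else 0) (p≗q zero)) (count-cong (p≗q ∘ suc))

count-mono : (∀ y → p y ≡ true → q y ≡ true) → count p ≤ count q
count-mono {zero}          p⇒q = z≤n
count-mono {suc m} {p} {q} p⇒q with p zero in p₀
... | true rewrite p⇒q zero p₀ = s≤s (count-mono (p⇒q ∘ suc))
... | false = ≤-trans (count-mono (p⇒q ∘ suc)) (m≤n+m _ _)

count-false : count {m} (λ _ → false) ≡ 0
count-false {zero}  = refl
count-false {suc m} = count-false {m}

count-remove : (p q : Fin m → Bool) (j : Fin m) → q j ≡ false → (∀ y → y ≢ j → p y ≡ q y) →
               count p ≡ (if p j then 1 else 0) + count q
count-remove p q zero q₀ p≗q rewrite q₀ =
  cong ((if p zero then 1 else 0) +_) (count-cong λ y → p≗q (suc y) λ ())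
count-remove p q (suc j) qj p≗q rewrite p≗q zero (λ ()) = begin
  [q₀] + count (p ∘ suc)       ≡⟨ cong ([q₀] +_) (count-remove (p ∘ suc) (q ∘ suc) j qj
                                    λ y y≢j → p≗q (suc y) (y≢j ∘ suc-injective)) ⟩
  [q₀] + ([pj] + count (q ∘ suc))  ≡⟨ x∙yz≈y∙xz [q₀] [pj] (count (q ∘ suc)) ⟩
  [pj] + ([q₀] + count (q ∘ suc))  ∎
  where
  open ≡-Reasoning
  [q₀] [pj] : ℕ
  [q₀] = if q zero then 1 else 0
  [pj] = if p (suc j) then 1 else 0

count-witness : 0 < count p → ∃ λ j → p j ≡ true
count-witness {suc m} {p} pos with p zero in p₀
... | true  = zero , p₀
... | false with count-witness pos
...   | j , pj = suc j , pj

count-singleton : (j : Fin m) → count (λ i → ⌊ j ≟ i ⌋) ≡ 1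
count-singleton {m} j = begin
  count (λ i → ⌊ j ≟ i ⌋)
    ≡⟨ count-remove (λ i → ⌊ j ≟ i ⌋) (λ _ → false) j refl
                    (λ i i≢j → ⌊⌋-false (j ≟ i) (i≢j ∘ sym)) ⟩
  (if ⌊ j ≟ j ⌋ then 1 else 0) + count {m} (λ _ → false)
    ≡⟨ cong₂ (λ b n → (if b then 1 else 0) + n) (⌊⌋-true (j ≟ j) refl) (count-false {m}) ⟩
  1 ∎
  where open ≡-Reasoning

count≡∑ : (p : Fin m → Bool) → count p ≡ sum (λ y → if p y then 1 else 0)
count≡∑ {zero}  p = refl
count≡∑ {suc m} p = cong ((if p zero then 1 else 0) +_) (count≡∑ (p ∘ suc))

count-partition : (p : Fin m → Bool) (f : Fin m → Fin l) →
                  count p ≡ sum (λ i → count (λ y → p y ∧ ⌊ f y ≟ i ⌋))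
count-partition {m} {l} p f = begin
  count p
    ≡⟨ count≡∑ p ⟩
  sum (λ y → [ p y ])
    ≡⟨ sum-cong-≗ (λ y → indicator (p y) (f y)) ⟩
  sum (λ y → sum (λ i → [ p y ∧ ⌊ f y ≟ i ⌋ ]))
    ≡⟨ ∑-comm {m} {l} (λ y i → [ p y ∧ ⌊ f y ≟ i ⌋ ]) ⟩
  sum (λ i → sum (λ y → [ p y ∧ ⌊ f y ≟ i ⌋ ]))
    ≡⟨ sum-cong-≗ (λ i → sym (count≡∑ λ y → p y ∧ ⌊ f y ≟ i ⌋)) ⟩
  sum (λ i → count (λ y → p y ∧ ⌊ f y ≟ i ⌋))
    ∎
  where
  open ≡-Reasoning
  [_] : Bool → ℕ
  [ b ] = if b then 1 else 0
  indicator : ∀ b (j : Fin l) → [ b ] ≡ sum (λ i → [ b ∧ ⌊ j ≟ i ⌋ ])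
  indicator true  j = trans (sym (count-singleton j)) (count≡∑ λ i → ⌊ j ≟ i ⌋)
  indicator false j = trans (sym (count-false {l})) (count≡∑ {l} λ _ → false)

-- Deleting and recolouring an edge

Colouring : ℕ → ℕ → Set
Colouring n l = Fin n → Fin n → Fin l

IsSymmetric : Colouring n l → Set
IsSymmetric c = ∀ x y → c x y ≡ c y x

degree≡∑colourDegree : (G : Graph n) (c : Colouring n l) (v : Fin n) →
                       degree G v ≡ sum (colourDegree G c v)
degree≡∑colourDegree G c v = count-partition (adj G v) (c v)

colourDegree-witness : ∀ {G : Graph n} {c : Colouring n l} {v a} → 0 < colourDegree G c v a →
                       ∃ λ w → adj G v w ≡ true × c v w ≡ a
colourDegree-witness {G = G} {c} {v} {a} pos with count-witness pos
... | w , e with adj G v w in vw | c v w ≟ a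
...   | true  | yes cvw = w , vw , cvw
...   | false | _ with () ← e
...   | true  | no _ with () ← e

Joins : Fin n → Fin n → Fin n → Fin n → Set
Joins v w x y = (x ≡ v × y ≡ w) ⊎ (x ≡ w × y ≡ v)

-- Opaque, so that `with joins? v w x y` can abstract it in goals.
opaque
  joins? : (v w x y : Fin n) → Dec (Joins v w x y)
  joins? v w x y = (x ≟ v ×-dec y ≟ w) ⊎-dec (x ≟ w ×-dec y ≟ v)

Joins-sym : {v w x y : Fin n} → Joins v w x y → Joins v w y x
Joins-sym = Sum.swap ∘ Sum.map Prod.swap Prod.swap

deleteEdge : Graph n → Fin n → Fin n → Graph n
deleteEdge G v w = record
  { adj    = λ x y → adj G x y ∧ not (does (joins? v w x y))
  ; sym    = λ x y → cong₂ (λ e j → e ∧ not j) (Graph.sym G x y)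
                       (does-⇔ (mk⇔ Joins-sym Joins-sym) (joins? v w x y) (joins? v w y x))
  ; irrefl = λ x → cong (λ e → e ∧ _) (irrefl G x)
  }

recolour : Colouring n l → Fin n → Fin n → Fin l → Colouring n l
recolour c v w b x y = if does (joins? v w x y) then b else c x y

recolour-joins : ∀ (c : Colouring n l) {v w x y} b → Joins v w x y → recolour c v w b x y ≡ b
recolour-joins c {v} {w} {x} {y} b J rewrite dec-true (joins? v w x y) J = refl

recolour-sym : ∀ {c : Colouring n l} → IsSymmetric c → ∀ v w b → IsSymmetric (recolour c v w b)
recolour-sym c-sym v w b x y
  rewrite does-⇔ (mk⇔ Joins-sym Joins-sym) (joins? v w x y) (joins? v w y x) =
  cong (if does (joins? v w y x) then b else_) (c-sym x y)

module _ {G : Graph n} {v w : Fin n} where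

  adj⇒≢ : adj G v w ≡ true → v ≢ w
  adj⇒≢ vw refl with () ← trans (sym vw) (irrefl G v)

  deleteEdge-⊆ : ∀ {x y} → adj (deleteEdge G v w) x y ≡ true → adj G x y ≡ true
  deleteEdge-⊆ {x} {y} e with adj G x y
  ... | true = refl

  deleteEdge-removes : adj (deleteEdge G v w) v w ≡ false
  deleteEdge-removes rewrite dec-true (joins? v w v w) (inj₁ (refl , refl)) = ∧-zeroʳ (adj G v w)

  deleteEdge-keeps : ∀ {x y} → ¬ Joins v w x y → adj (deleteEdge G v w) x y ≡ adj G x y
  deleteEdge-keeps {x} {y} ¬J rewrite dec-false (joins? v w x y) ¬J = ∧-identityʳ (adj G x y)

  ¬Joins-from : v ≢ w → ∀ {y} → y ≢ w → ¬ Joins v w v y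
  ¬Joins-from v≢w y≢w (inj₁ (_ , y≡w)) = y≢w y≡w
  ¬Joins-from v≢w y≢w (inj₂ (v≡w , _)) = v≢w v≡w

  degree-deleteEdge : adj G v w ≡ true → degree G v ≡ suc (degree (deleteEdge G v w) v)
  degree-deleteEdge vw = trans
    (count-remove (adj G v) (adj (deleteEdge G v w) v) w deleteEdge-removes
      λ y y≢w → sym (deleteEdge-keeps (¬Joins-from (adj⇒≢ vw) y≢w)))
    (cong (λ e → (if e then 1 else 0) + degree (deleteEdge G v w) v) vw)

  colourDegree-deleteEdge : adj G v w ≡ true → (d : Colouring n l) (i : Fin l) →
    colourDegree G d v i ≡ (if ⌊ d v w ≟ i ⌋ then 1 else 0) + colourDegree (deleteEdge G v w) d v i
  colourDegree-deleteEdge vw d i = trans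
    (count-remove _ _ w (cong (_∧ _) deleteEdge-removes)
      λ y y≢w → cong (_∧ _) (sym (deleteEdge-keeps (¬Joins-from (adj⇒≢ vw) y≢w))))
    (cong (λ e → (if e ∧ ⌊ d v w ≟ i ⌋ then 1 else 0) + colourDegree (deleteEdge G v w) d v i) vw)

  colourDegree-deleteEdge-away : ∀ {x} → x ≢ v → x ≢ w → (d : Colouring n l) (i : Fin l) →
    colourDegree (deleteEdge G v w) d x i ≡ colourDegree G d x i
  colourDegree-deleteEdge-away {x = x} x≢v x≢w d i = count-cong λ y →
    cong (_∧ ⌊ d x y ≟ i ⌋) (deleteEdge-keeps λ { (inj₁ (x≡v , _)) → x≢v x≡v
                                                ; (inj₂ (x≡w , _)) → x≢w x≡w })

  colourDegree-deleteEdge-comm : ∀ (d : Colouring n l) x i →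
    colourDegree (deleteEdge G v w) d x i ≡ colourDegree (deleteEdge G w v) d x i
  colourDegree-deleteEdge-comm d x i = count-cong λ y → cong (λ j → (adj G x y ∧ not j) ∧ _)
    (does-⇔ (mk⇔ Sum.swap Sum.swap) (joins? v w x y) (joins? w v x y))

  colourDegree-recolour : ∀ (d : Colouring n l) b x i →
    colourDegree (deleteEdge G v w) (recolour d v w b) x i ≡ colourDegree (deleteEdge G v w) d x i
  colourDegree-recolour d b x i = count-cong same
    where
    same : ∀ y → adj (deleteEdge G v w) x y ∧ ⌊ recolour d v w b x y ≟ i ⌋
               ≡ adj (deleteEdge G v w) x y ∧ ⌊ d x y ≟ i ⌋
    same y with joins? v w x y
    ... | yes _ rewrite ∧-zeroʳ (adj G x y) = refl
    ... | no _  = refl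

degreeSum : Graph n → ℕ
degreeSum G = sum (degree G)

deleteEdge-degreeSum : ∀ {G : Graph n} {v w} → adj G v w ≡ true →
                       degreeSum (deleteEdge G v w) < degreeSum G
deleteEdge-degreeSum {G = G} {v} {w} vw =
  ∑-mono-< (λ x → count-mono {p = adj (deleteEdge G v w) x} λ y → deleteEdge-⊆ {G = G})
           v (≤-reflexive (sym (degree-deleteEdge {G = G} vw)))

-- Local effect of swapping two colours

Shifted : Graph n → Colouring n l → Colouring n l → Fin n → Fin l → Fin l → Set
Shifted G c′ c x a b =
  suc (colourDegree G c′ x a) ≡ colourDegree G c x a × colourDegree G c′ x b ≡ suc (colourDegree G c x b)

ShiftedDown : Graph n → Colouring n l → Colouring n l → Fin n → Fin l → Fin l → Set
ShiftedDown G c′ c x a b = colourDegree G c x b < colourDegree G c x a × Shifted G c′ c x a b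

Unchanged : Graph n → Colouring n l → Colouring n l → Fin n → Fin l → Fin l → Set
Unchanged G c′ c x a b =
  colourDegree G c′ x a ≡ colourDegree G c x a × colourDegree G c′ x b ≡ colourDegree G c x b

OnlyRecolours : Fin l → Fin l → Colouring n l → Colouring n l → Set
OnlyRecolours a b c c′ = ∀ x y i → i ≢ a → i ≢ b → ⌊ c′ x y ≟ i ⌋ ≡ ⌊ c x y ≟ i ⌋

OnlyRecolours-flip : ∀ {a b : Fin l} {c c′ : Colouring n l} →
                     OnlyRecolours a b c c′ → OnlyRecolours b a c c′
OnlyRecolours-flip only x y i i≢b i≢a = only x y i i≢a i≢b

colourDegree-only : ∀ {G : Graph n} {a b : Fin l} {c c′} → OnlyRecolours a b c c′ →
                    ∀ x i → i ≢ a → i ≢ b → colourDegree G c′ x i ≡ colourDegree G c x i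
colourDegree-only {G = G} only x i i≢a i≢b =
  count-cong λ y → cong (adj G x y ∧_) (only x y i i≢a i≢b)

energyAt : Graph n → Colouring n l → Fin n → ℕ
energyAt G c x = sum (λ i → colourDegree G c x i * colourDegree G c x i)

energy : Graph n → Colouring n l → ℕ
energy G c = sum (energyAt G c)

square-shift : ∀ A B → A * A + suc B * suc B + (A + A) ≡ suc A * suc A + B * B + (B + B)
square-shift = solve-∀

shifted-squares-≤ : ∀ {A′ B′ A B} → suc A′ ≡ A → B′ ≡ suc B → B < A →
                    A′ * A′ + B′ * B′ ≤ A * A + B * B
shifted-squares-≤ {A′} {B′} {A} {B} refl refl (s≤s B≤A′) = +-cancelʳ-≤ (A′ + A′) _ _
  (subst (_≤ A * A + B * B + (A′ + A′)) (sym (square-shift A′ B))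
         (+-monoʳ-≤ (A * A + B * B) (+-mono-≤ B≤A′ B≤A′)))

shifted-squares-< : ∀ {A′ B′ A B} → suc A′ ≡ A → B′ ≡ suc B → suc B < A →
                    A′ * A′ + B′ * B′ < A * A + B * B
shifted-squares-< {A′} {B′} {A} {B} refl refl (s≤s B<A′) = +-cancelʳ-< (A′ + A′) _ _
  (subst (_< A * A + B * B + (A′ + A′)) (sym (square-shift A′ B))
         (+-monoʳ-< (A * A + B * B) (+-mono-< B<A′ B<A′)))

module _ {G : Graph n} {c c′ : Colouring n l} {a b : Fin l}
         (a≢b : a ≢ b) (only : OnlyRecolours a b c c′) (x : Fin n) where

  private
    sq : Colouring n l → Fin l → ℕ
    sq e i = colourDegree G e x i * colourDegree G e x i

    outside : ∀ i → i ≢ a → i ≢ b → sq c′ i ≡ sq c i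
    outside i i≢a i≢b = cong (λ t → t * t) (colourDegree-only {G = G} only x i i≢a i≢b)

  energyAt-unchanged : Unchanged G c′ c x a b → energyAt G c′ x ≤ energyAt G c x
  energyAt-unchanged (ea , eb) = ∑-≤-two (sq c′) (sq c) a≢b outside
    (≤-reflexive (cong₂ (λ s t → s * s + t * t) ea eb))

  energyAt-shiftedDown : ShiftedDown G c′ c x a b → energyAt G c′ x ≤ energyAt G c x
  energyAt-shiftedDown (b<a , ea , eb) =
    ∑-≤-two (sq c′) (sq c) a≢b outside (shifted-squares-≤ ea eb b<a)

  energyAt-shiftedDown-flip : ShiftedDown G c′ c x b a → energyAt G c′ x ≤ energyAt G c x
  energyAt-shiftedDown-flip (a<b , eb , ea) =
    ∑-≤-two (sq c′) (sq c) (a≢b ∘ sym) (λ i i≢b i≢a → outside i i≢a i≢b) (shifted-squares-≤ eb ea a<b)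

  energyAt-shifted : suc (colourDegree G c x b) < colourDegree G c x a → Shifted G c′ c x a b →
                     energyAt G c′ x < energyAt G c x
  energyAt-shifted gap (ea , eb) = ∑-<-two (sq c′) (sq c) a≢b outside (shifted-squares-< ea eb gap)

module AtEdge {G : Graph n} {v w : Fin n} (vw : adj G v w ≡ true)
              {c : Colouring n l} (c-sym : IsSymmetric c) {a b : Fin l} (a≢b : a ≢ b) (cvw : c v w ≡ a)
              where

  H : Graph n
  H = deleteEdge G v w

  colourDegree-endpoint : ∀ (e : Colouring n l) {x y} → Joins v w x y → ∀ i →
    colourDegree G e x i ≡ (if ⌊ e x y ≟ i ⌋ then 1 else 0) + colourDegree H e x i
  colourDegree-endpoint e (inj₁ (refl , refl)) i = colourDegree-deleteEdge {G = G} vw e i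
  colourDegree-endpoint e (inj₂ (refl , refl)) i =
    trans (colourDegree-deleteEdge {G = G} (trans (Graph.sym G w v) vw) e i)
          (cong (_ +_) (sym (colourDegree-deleteEdge-comm {G = G} e w i)))

  c-endpoint : ∀ {x y} → Joins v w x y → c x y ≡ a
  c-endpoint (inj₁ (refl , refl)) = cvw
  c-endpoint (inj₂ (refl , refl)) = trans (c-sym w v) cvw

  colourDegree-endpoint-a : ∀ {x y} → Joins v w x y → colourDegree G c x a ≡ suc (colourDegree H c x a)
  colourDegree-endpoint-a J = trans (colourDegree-endpoint c J a)
    (cong (λ t → (if t then 1 else 0) + colourDegree H c _ a) (⌊⌋-true (c _ _ ≟ a) (c-endpoint J)))

  colourDegree-endpoint-b : ∀ {x y} → Joins v w x y → colourDegree G c x b ≡ colourDegree H c x b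
  colourDegree-endpoint-b J = trans (colourDegree-endpoint c J b)
    (cong (λ t → (if t then 1 else 0) + colourDegree H c _ b)
          (⌊⌋-false (c _ _ ≟ b) (a≢b ∘ trans (sym (c-endpoint J)))))

  module Recoloured (d : Colouring n l) where

    c′ : Colouring n l
    c′ = recolour d v w b

    c′-colourDegree-endpoint-a : ∀ {x y} → Joins v w x y → colourDegree G c′ x a ≡ colourDegree H d x a
    c′-colourDegree-endpoint-a {x} {y} J = begin
      colourDegree G c′ x a
        ≡⟨ colourDegree-endpoint c′ J a ⟩
      (if ⌊ c′ x y ≟ a ⌋ then 1 else 0) + colourDegree H c′ x a
        ≡⟨ cong₂ (λ t n → (if t then 1 else 0) + n)
                 (⌊⌋-false (c′ x y ≟ a) λ e → a≢b (trans (sym e) (recolour-joins d b J)))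
                 (colourDegree-recolour {G = G} d b x a) ⟩
      colourDegree H d x a
        ∎
      where open ≡-Reasoning

    c′-colourDegree-endpoint-b : ∀ {x y} → Joins v w x y →
                                 colourDegree G c′ x b ≡ suc (colourDegree H d x b)
    c′-colourDegree-endpoint-b {x} {y} J = begin
      colourDegree G c′ x b
        ≡⟨ colourDegree-endpoint c′ J b ⟩
      (if ⌊ c′ x y ≟ b ⌋ then 1 else 0) + colourDegree H c′ x b
        ≡⟨ cong₂ (λ t n → (if t then 1 else 0) + n)
                 (⌊⌋-true (c′ x y ≟ b) (recolour-joins d b J))
                 (colourDegree-recolour {G = G} d b x b) ⟩
      suc (colourDegree H d x b)
        ∎
      where open ≡-Reasoning

    c′-colourDegree-away : ∀ {x} → x ≢ v → x ≢ w → ∀ i → colourDegree G c′ x i ≡ colourDegree H d x i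
    c′-colourDegree-away x≢v x≢w i =
      trans (sym (colourDegree-deleteEdge-away {G = G} x≢v x≢w c′ i)) (colourDegree-recolour {G = G} d b _ i)

    shifted-endpoint : ∀ {x y} → Joins v w x y → Unchanged H d c x a b → Shifted G c′ c x a b
    shifted-endpoint J (da , db) =
        trans (cong suc (trans (c′-colourDegree-endpoint-a J) da)) (sym (colourDegree-endpoint-a J))
      , trans (c′-colourDegree-endpoint-b J) (cong suc (trans db (sym (colourDegree-endpoint-b J))))

    unchanged-endpoint : ∀ {x y} → Joins v w x y → Shifted H d c x b a → Unchanged G c′ c x a b
    unchanged-endpoint J (db , da) =
        trans (c′-colourDegree-endpoint-a J) (trans da (sym (colourDegree-endpoint-a J)))
      , trans (c′-colourDegree-endpoint-b J) (trans db (sym (colourDegree-endpoint-b J)))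

    unchanged-away : ∀ {x} → x ≢ v → x ≢ w → Unchanged H d c x a b → Unchanged G c′ c x a b
    unchanged-away x≢v x≢w (da , db) =
        trans (c′-colourDegree-away x≢v x≢w a) (trans da (colourDegree-deleteEdge-away {G = G} x≢v x≢w c a))
      , trans (c′-colourDegree-away x≢v x≢w b) (trans db (colourDegree-deleteEdge-away {G = G} x≢v x≢w c b))

    shiftedDown-away : ∀ {x} → x ≢ v → x ≢ w → ∀ {i j} →
                       ShiftedDown H d c x i j → ShiftedDown G c′ c x i j
    shiftedDown-away x≢v x≢w {i} {j} down
      rewrite sym (c′-colourDegree-away x≢v x≢w i) | sym (c′-colourDegree-away x≢v x≢w j)
            | colourDegree-deleteEdge-away {G = G} x≢v x≢w c i
            | colourDegree-deleteEdge-away {G = G} x≢v x≢w c j = down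

    c′-sym : IsSymmetric d → IsSymmetric c′
    c′-sym d-sym = recolour-sym d-sym v w b

    c′-only : OnlyRecolours a b c d → OnlyRecolours a b c c′
    c′-only only x y i i≢a i≢b with joins? v w x y
    ... | yes J = trans (⌊⌋-false (b ≟ i) (i≢b ∘ sym))
                        (sym (⌊⌋-false (c x y ≟ i) λ e → i≢a (trans (sym e) (c-endpoint J))))
    ... | no _  = only x y i i≢a i≢b

Equitable : Graph n → Colouring n l → Set
Equitable G c = ∀ x i j → colourDegree G c x i ≤ suc (colourDegree G c x j)

balanced? : (G : Graph n) (c : Colouring n l) →
            ∀ x i j → Dec (colourDegree G c x i ≤ suc (colourDegree G c x j))
balanced? G c x i j = colourDegree G c x i ≤? suc (colourDegree G c x j)

equitable-or-gap : (G : Graph n) (c : Colouring n l) →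
  Equitable G c ⊎ ∃ λ x → ∃ λ i → ∃ λ j → suc (colourDegree G c x j) < colourDegree G c x i
equitable-or-gap {n} {l} G c with all? (λ x → all? (λ i → all? (balanced? G c x i)))
... | yes equitable = inj₁ equitable
... | no ¬equitable with ¬∀⟶∃¬ n _ (λ x → all? (λ i → all? (balanced? G c x i))) ¬equitable
...   | x , ¬x with ¬∀⟶∃¬ l _ (λ i → all? (balanced? G c x i)) ¬x
...     | i , ¬xi with ¬∀⟶∃¬ l _ (balanced? G c x i) ¬xi
...       | j , ¬xij = inj₂ (x , i , j , ≰⇒> ¬xij)

-- Switching along an alternating trail

module _ (side : Fin n → Bool) where

  Separates : Graph n → Set
  Separates G = ∀ x y → adj G x y ≡ true → side x ≢ side y

  record Switching (G : Graph n) (c : Colouring n l) (v : Fin n) (a b : Fin l) : Set where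
    field
      colouring : Colouring n l
      symmetric : IsSymmetric colouring
      recolours : OnlyRecolours a b c colouring
      end       : Fin n
      end≢start : end ≢ v
      at-start  : Shifted G colouring c v a b
      -- the sides of the two ends record the parity of the trail
      at-end    : side end ≢ side v × ShiftedDown G colouring c end a b
                ⊎ side end ≡ side v × ShiftedDown G colouring c end b a
      elsewhere : ∀ x → x ≢ v → x ≢ end → Unchanged G colouring c x a b

  module _ {G : Graph n} (sep : Separates G) {v w : Fin n} (vw : adj G v w ≡ true)
           {c : Colouring n l} (c-sym : IsSymmetric c) {a b : Fin l} (a≢b : a ≢ b) (cvw : c v w ≡ a)
           where

    open AtEdge {G = G} vw c-sym a≢b cvw

    private
      v≢w : v ≢ w
      v≢w = adj⇒≢ {G = G} vw

      sw≢sv : side w ≢ side v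
      sw≢sv = sep w v (trans (Graph.sym G w v) vw)

      vw-joins : Joins v w v w
      vw-joins = inj₁ (refl , refl)

      wv-joins : Joins v w w v
      wv-joins = inj₂ (refl , refl)

    switch-edge : colourDegree G c w b < colourDegree G c w a → Switching G c v a b
    switch-edge b<a = record
      { colouring = c′
      ; symmetric = c′-sym c-sym
      ; recolours = c′-only λ _ _ _ _ _ → refl
      ; end       = w
      ; end≢start = v≢w ∘ sym
      ; at-start  = shifted-endpoint vw-joins (refl , refl)
      ; at-end    = inj₁ (sw≢sv , b<a , shifted-endpoint wv-joins (refl , refl))
      ; elsewhere = λ x x≢v x≢w → unchanged-away x≢v x≢w (refl , refl)
      }
      where open Recoloured c

    reversed-gap-at-w : ¬ (colourDegree G c w b < colourDegree G c w a) →
                        colourDegree H c w a < colourDegree H c w b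
    reversed-gap-at-w b≮a =
      subst₂ _≤_ (colourDegree-endpoint-a wv-joins) (colourDegree-endpoint-b wv-joins) (≮⇒≥ b≮a)

    switch-extend : colourDegree G c v b < colourDegree G c v a → Switching H c w b a →
                    Switching G c v a b
    switch-extend b<a S = record
      { colouring = c′
      ; symmetric = c′-sym S.symmetric
      ; recolours = c′-only (OnlyRecolours-flip S.recolours)
      ; end       = z
      ; end≢start = z≢v
      ; at-start  = shifted-endpoint vw-joins (Prod.swap (S.elsewhere v v≢w (z≢v ∘ sym)))
      ; at-end    = at-end
      ; elsewhere = elsewhere
      }
      where
      module S = Switching S
      open Recoloured S.colouring
      z = S.end

      -- An even trail could only end at v if a were lighter than b there, an odd one not at all.
      z≢v : z ≢ v
      z≢v refl with S.at-end
      ... | inj₁ (_ , a<b , _) = <⇒≱ b<a (subst₂ _≤_ (sym (colourDegree-endpoint-a vw-joins))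
                                                     (sym (colourDegree-endpoint-b vw-joins)) a<b)
      ... | inj₂ (sv≡sw , _)   = sw≢sv (sym sv≡sw)

      at-end : side z ≢ side v × ShiftedDown G c′ c z a b ⊎ side z ≡ side v × ShiftedDown G c′ c z b a
      at-end with S.at-end
      ... | inj₁ (sz≢sw , down) = inj₂ (≢-≢⇒≡ sz≢sw sw≢sv , shiftedDown-away z≢v S.end≢start down)
      ... | inj₂ (sz≡sw , down) =
        inj₁ ((λ sz≡sv → sw≢sv (trans (sym sz≡sw) sz≡sv)) , shiftedDown-away z≢v S.end≢start down)

      elsewhere : ∀ x → x ≢ v → x ≢ z → Unchanged G c′ c x a b
      elsewhere x x≢v x≢z with x ≟ w
      ... | yes refl = unchanged-endpoint wv-joins S.at-start
      ... | no x≢w   = unchanged-away x≢v x≢w (Prod.swap (S.elsewhere x x≢w x≢z))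

  switch : (G : Graph n) → Acc _<_ (degreeSum G) → Separates G → {c : Colouring n l} → IsSymmetric c →
           {v : Fin n} {a b : Fin l} → a ≢ b → colourDegree G c v b < colourDegree G c v a →
           Switching G c v a b
  switch G (acc smaller) sep {c} c-sym {v} {a} {b} a≢b b<a
    with colourDegree-witness {G = G} {c} (≤-trans (s≤s z≤n) b<a)
  ... | w , vw , cvw with colourDegree G c w b <? colourDegree G c w a
  ...   | yes b<a-at-w = switch-edge sep vw c-sym a≢b cvw b<a-at-w
  ...   | no  b≮a-at-w = switch-extend sep vw c-sym a≢b cvw b<a
          (switch (deleteEdge G v w) (smaller (deleteEdge-degreeSum {G = G} vw))
                  (λ x y → sep x y ∘ deleteEdge-⊆ {G = G}) c-sym (a≢b ∘ sym)
                  (reversed-gap-at-w {G = G} sep vw c-sym a≢b cvw b≮a-at-w))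

  switching-energy : ∀ {G : Graph n} {c : Colouring n l} {v a b} (S : Switching G c v a b) → a ≢ b →
                     suc (colourDegree G c v b) < colourDegree G c v a →
                     energy G (Switching.colouring S) < energy G c
  switching-energy {G = G} {c} {v} S a≢b gap = ∑-mono-< local v at-v
    where
    module S = Switching S
    at-v : energyAt G S.colouring v < energyAt G c v
    at-v = energyAt-shifted {G = G} a≢b S.recolours v gap S.at-start
    local : ∀ x → energyAt G S.colouring x ≤ energyAt G c x
    local x with x ≟ v | x ≟ S.end
    ... | yes refl | _        = <⇒≤ at-v
    ... | no x≢v   | no x≢z   = energyAt-unchanged {G = G} a≢b S.recolours x (S.elsewhere x x≢v x≢z)
    ... | no _     | yes refl with S.at-end
    ...   | inj₁ (_ , down) = energyAt-shiftedDown {G = G} a≢b S.recolours x down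
    ...   | inj₂ (_ , down) = energyAt-shiftedDown-flip {G = G} a≢b S.recolours x down

  equitable-colouring : (G : Graph n) → Separates G →
                        ∃ λ (c : Colouring n (suc l)) → IsSymmetric c × Equitable G c
  equitable-colouring G sep = descend (λ _ _ → zero) (λ _ _ → refl) (<-wellFounded _)
    where
    descend : (c : Colouring n (suc l)) → IsSymmetric c → Acc _<_ (energy G c) →
              ∃ λ (c : Colouring n (suc l)) → IsSymmetric c × Equitable G c
    descend c c-sym (acc smaller) with equitable-or-gap G c
    ... | inj₁ equitable = c , c-sym , equitable
    ... | inj₂ (x , i , j , gap) = descend S.colouring S.symmetric (smaller (switching-energy S i≢j gap))
      where
      i≢j : i ≢ j
      i≢j refl = <⇒≱ gap (n≤1+n _)
      S = switch G (<-wellFounded _) sep c-sym i≢j (<-trans (n<1+n _) gap)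
      module S = Switching S

-- Equitable colourings are majority colourings

m≤n⇒m*n≤n+m*[n∸1] : ∀ {m n} → m ≤ n → m * n ≤ n + m * (n ∸ 1)
m≤n⇒m*n≤n+m*[n∸1] {n = zero}  _   = ≤-refl
m≤n⇒m*n≤n+m*[n∸1] {m} {suc n} m≤n = begin
  m * suc n      ≡⟨ *-suc m n ⟩
  m + m * n      ≤⟨ +-monoˡ-≤ (m * n) m≤n ⟩
  suc n + m * n  ∎
  where open ≤-Reasoning

equitable⇒majority : ∀ k (f : Fin (suc k) → ℕ) → (∀ i j → f i ≤ suc (f j)) → k * (k ∸ 1) ≤ sum f →
                     ∀ i → k * f i ≤ sum f
equitable⇒majority k f balanced large i with k ≤? f i
... | no  k≰fi = ≤-trans (*-monoʳ-≤ k (∸-monoˡ-≤ 1 (≰⇒> k≰fi))) large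
... | yes k≤fi = begin
  k * f i                        ≤⟨ m≤n⇒m*n≤n+m*[n∸1] k≤fi ⟩
  f i + k * (f i ∸ 1)            ≡⟨ cong (f i +_) (∑-const k (f i ∸ 1)) ⟨
  f i + sum {k} (λ _ → f i ∸ 1)  ≤⟨ +-monoʳ-≤ (f i) (∑-mono-≤ λ j →
                                      ∸-monoˡ-≤ 1 (balanced i (punchIn i j))) ⟩
  f i + sum (removeAt f i)       ≡⟨ sum-remove f ⟨
  sum f                          ∎
  where open ≤-Reasoning

-- The argument works for every k.
theorem5 : (k : ℕ) → 2 ≤ k → (n : ℕ) → (G : Graph n) → Bipartite G →
    MinDegreeAtLeast G (k * (k ∸ 1)) → HasMajorityColouring G k (suc k)
theorem5 k _ n G (side , separated) min-degree with equitable-colouring side {l = k} G separated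
... | c , c-sym , equitable = (c , λ x y _ → c-sym x y) , majority
  where
  majority : IsMajorityColouring G k c
  majority v i = subst (k * colourDegree G c v i ≤_) (sym (degree≡∑colourDegree G c v))
    (equitable⇒majority k (colourDegree G c v) (equitable v)
      (subst (k * (k ∸ 1) ≤_) (degree≡∑colourDegree G c v) (min-degree v)) i)
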